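{- Let $X\in\{\mathrm{K4\times S5}, \mathrm{S4\times S5}, \mathrm{SSL}\}$. Let $\varphi$ be a bimodal formula. Let $(\mathcal{F}_0,\ldots,\mathcal{F}_m)$ for some $m\geq 0$ be a sequence of pairwise different $X$-tableau-clouds with respect to $\varphi$ satisfying $\mathcal{F}_i \leq_X \mathcal{F}_{i+1}$ for all $i<m$. Then $\mathit{alg}_{X}(\varphi, \mathcal{F}_0,\ldots,\mathcal{F}_m)$ returns ``yes'' if, and only if, there exists a partial $X$-tableau for $(\varphi,\mathcal{F}_0,\ldots,\mathcal{F}_m)$.
   Context: Bimodal formulas are built from propositional variables (the set $AT$) using $\neg$, $\wedge$, and the unary modal operators $\Box$ and $K$; $\mathrm{sf}(\varphi)$ denotes the (finite) set of subformulas of $\varphi$, and for $\circ\in\{\Box,K\}$, $\mathcal{L}_\circ$ is the set of formulas of the form $\circ\chi$. A $\mathrm{K4\times S5}$-tableau-set with respect to $\varphi$ is a set $F\subseteq\mathrm{sf}(\varphi)$ such that for all $\psi\in\mathrm{sf}(\varphi)$: if $\psi=\neg\chi$ then ($\psi\in F\iff\chi\notin F$); if $\psi=(\chi_1\wedge\chi_2)$ then ($\psi\in F\iff\chi_1\in F$ and $\chi_2\in F$); if $\psi=K\chi$ then ($\psi\in F\Rightarrow\chi\in F$). For $X\in\{\mathrm{S4\times S5},\mathrm{SSL}\}$ an $X$-tableau-set additionally satisfies: if $\psi=\Box\chi$ then ($\psi\in F\Rightarrow\chi\in F$). $\mathcal{T}^X_\varphi$ is the set of all $X$-tableau-sets with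 respect to $\varphi$. An $X$-tableau-cloud with respect to $\varphi$ is a set $\mathcal{F}\subseteq\mathcal{T}^X_\varphi$ such that (a) $F\cap\mathcal{L}_K=G\cap\mathcal{L}_K$ for all $F,G\in\mathcal{F}$, and (b) for all $\chi$ with $K\chi\in\mathrm{sf}(\varphi)$, if $\chi\in\bigcap_{F\in\mathcal{F}}F$ then $K\chi\in\bigcap_{F\in\mathcal{F}}F$. $\mathfrak{C}^X_\varphi$ is the set of all $X$-tableau-clouds with respect to $\varphi$. For $F,G\in\mathcal{T}^X_\varphi$, $F\preccurlyeq_X G$ means: for $X=\mathrm{K4\times S5}$, $F\cap\mathcal{L}_\Box\subseteq G$ and $\{\psi\mid\Box\psi\in F\}\subseteq G$; for $X=\mathrm{S4\times S5}$, $F\cap\mathcal{L}_\Box\subseteq G$; for $X=\mathrm{SSL}$, $F\cap\mathcal{L}_\Box\subseteq G$ and $F\cap AT=G\cap AT$. For $\mathcal{F},\mathcal{G}\subseteq\mathcal{T}^X_\varphi$, $\mathcal{F}\leq_X\mathcal{G}$ means: for $X\in\{\mathrm{K4\times S5},\mathrm{S4\times S5}\}$, every $G\in\mathcal{G}$ has some $F\in\mathcal{F}$ with $F\preccurlyeq_X G$ and every $F\in\mathcal{F}$ has some $G\in\mathcal{G}$ with $F\preccurlyeq_X G$; for $X=\mathrm{SSL}$, only the first of these two conditions. Given pairwise different $\mathcal{F}_0,\ldots,\mathcal{F}_m\in\mathfrak{C}^X_\varphi$ with $\mathcal{F}_i\leq_X\mathcal{F}_{i+1}$ for $i<m$, a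 partial $X$-tableau for $(\varphi,\mathcal{F}_0,\ldots,\mathcal{F}_m)$ is a set $\mathfrak{T}\subseteq\mathfrak{C}^X_\varphi$ such that (1) $\mathcal{F}_i\in\mathfrak{T}$ for $i=0,\ldots,m$, and (2) for all $\mathcal{F}\in\mathfrak{T}\setminus\{\mathcal{F}_0,\ldots,\mathcal{F}_{m-1}\}$, all $F\in\mathcal{F}$ and all $\chi$ with $\Box\chi\in\mathrm{sf}(\varphi)$, if $\Box\chi\notin F$ then there is $\mathcal{G}\in\mathfrak{T}$ with $\mathcal{F}\leq_X\mathcal{G}$ and some $G\in\mathcal{G}$ with $F\preccurlyeq_X G$ and $\chi\notin G$. The recursive procedure $\mathit{alg}_X(\varphi,\mathcal{F}_0,\ldots,\mathcal{F}_m)$ (on such a sequence) checks for every pair $(\Box\chi,F)\in\mathrm{sf}(\varphi)\times\mathcal{F}_m$ with $\Box\chi\notin F$: (I) whether there is $i\in\{0,\ldots,m\}$ with $\mathcal{F}_m\leq_X\mathcal{F}_i$ and some $G\in\mathcal{F}_i$ with $F\preccurlyeq_X G$ and $\chi\notin G$; and if not, (II) whether there is $\mathcal{F}_{m+1}\in\mathfrak{C}^X_\varphi\setminus\{\mathcal{F}_0,\ldots,\mathcal{F}_m\}$ with $\mathcal{F}_m\leq_X\mathcal{F}_{m+1}$, some $G\in\mathcal{F}_{m+1}$ with $F\preccurlyeq_X G$ and $\chi\notin G$, and such that $\mathit{alg}_X(\varphi,\mathcal{F}_0,\ldots,\mathcal{F}_m,\mathcal{F}_{m+1})$ returns ``yes''.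 It returns ``yes'' iff for every such pair (I) or (II) holds, and ``no'' otherwise. -}

module Defs where

open import Data.Nat using (ℕ; suc)
import Data.Nat.Properties as ℕP
open import Data.Bool using (Bool)
open import Data.Fin using (Fin; inject₁)
open import Data.Fin.Subset using (Subset) renaming (_∈_ to _∈ₛ_)
open import Data.List using (List; length; deduplicate) renaming (lookup to lookupL)
open import Data.List.Membership.Propositional using (_∈_)
open import Data.List.Relation.Unary.All using (All)
open import Data.List.Relation.Unary.Any using (Any)
open import Data.Vec using (Vec; lookup; last; _∷ʳ_)
open import Data.Product using (Σ; _×_; _,_)
open import Data.Sum using (_⊎_)
open import Data.Unit using (⊤)
open import Relation.Nullary using (¬_; yes; no)
open import Relation.Binary.PropositionalEquality using (_≡_; refl; cong; cong₂)
open import Relation.Binary.Definitions using (DecidableEquality)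

infix 2 _⟺_
_⟺_ : Set → Set → Set
A ⟺ B = (A → B) × (B → A)

data Fm : Set where
  var  : ℕ → Fm
  ¬'_  : Fm → Fm
  _∧'_ : Fm → Fm → Fm
  □_   : Fm → Fm
  K_   : Fm → Fm

private
  var-inj : ∀ {p q} → var p ≡ var q → p ≡ q
  var-inj refl = refl
  neg-inj : ∀ {a b} → (¬' a) ≡ (¬' b) → a ≡ b
  neg-inj refl = refl
  box-inj : ∀ {a b} → (□ a) ≡ (□ b) → a ≡ b
  box-inj refl = refl
  k-inj : ∀ {a b} → (K a) ≡ (K b) → a ≡ b
  k-inj refl = refl
  and-inj₁ : ∀ {a b c d} → (a ∧' b) ≡ (c ∧' d) → a ≡ c
  and-inj₁ refl = refl
  and-inj₂ : ∀ {a b c d} → (a ∧' b) ≡ (c ∧' d) → b ≡ d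
  and-inj₂ refl = refl

_≟F_ : DecidableEquality Fm
var p ≟F var q with p ℕP.≟ q
... | yes e = yes (cong var e)
... | no ne = no λ e → ne (var-inj e)
var _ ≟F (¬' _) = no λ ()
var _ ≟F (_ ∧' _) = no λ ()
var _ ≟F (□ _) = no λ ()
var _ ≟F (K _) = no λ ()
(¬' _) ≟F var _ = no λ ()
(¬' a) ≟F (¬' b) with a ≟F b
... | yes e = yes (cong ¬'_ e)
... | no ne = no λ e → ne (neg-inj e)
(¬' _) ≟F (_ ∧' _) = no λ ()
(¬' _) ≟F (□ _) = no λ ()
(¬' _) ≟F (K _) = no λ ()
(_ ∧' _) ≟F var _ = no λ ()
(_ ∧' _) ≟F (¬' _) = no λ ()
(a ∧' b) ≟F (c ∧' d) with a ≟F c | b ≟F d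
... | yes e₁ | yes e₂ = yes (cong₂ _∧'_ e₁ e₂)
... | no ne | _ = no λ e → ne (and-inj₁ e)
... | yes _ | no ne = no λ e → ne (and-inj₂ e)
(_ ∧' _) ≟F (□ _) = no λ ()
(_ ∧' _) ≟F (K _) = no λ ()
(□ _) ≟F var _ = no λ ()
(□ _) ≟F (¬' _) = no λ ()
(□ _) ≟F (_ ∧' _) = no λ ()
(□ a) ≟F (□ b) with a ≟F b
... | yes e = yes (cong □_ e)
... | no ne = no λ e → ne (box-inj e)
(□ _) ≟F (K _) = no λ ()
(K _) ≟F var _ = no λ ()
(K _) ≟F (¬' _) = no λ ()
(K _) ≟F (_ ∧' _) = no λ ()
(K _) ≟F (□ _) = no λ ()
(K a) ≟F (K b) with a ≟F b
... | yes e = yes (cong K_ e)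
... | no ne = no λ e → ne (k-inj e)

sfList : Fm → List Fm
sfList (var p)  = var p Data.List.∷ Data.List.[]
sfList (¬' a)   = (¬' a) Data.List.∷ sfList a
sfList (a ∧' b) = (a ∧' b) Data.List.∷ (sfList a Data.List.++ sfList b)
sfList (□ a)    = (□ a) Data.List.∷ sfList a
sfList (K a)    = (K a) Data.List.∷ sfList a

-- sf(φ) as a repetition-free list; a subset of sf(φ) is then a Subset of its positions
sf : Fm → List Fm
sf φ = deduplicate _≟F_ (sfList φ)

data Logic : Set where
  K4×S5 S4×S5 SSL : Logic

module Tab (X : Logic) (φ : Fm) where

  n : ℕ
  n = length (sf φ)

  FSet : Set
  FSet = Subset n

  infix 4 _∈F_
  _∈F_ : Fm → FSet → Set
  ψ ∈F F = Σ (Fin n) λ i → lookupL (sf φ) i ≡ ψ × i ∈ₛ F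

  BoxClause : Logic → Fm → FSet → Set
  BoxClause K4×S5 χ F = ⊤
  BoxClause S4×S5 χ F = □ χ ∈F F → χ ∈F F
  BoxClause SSL   χ F = □ χ ∈F F → χ ∈F F

  TSClause : Fm → FSet → Set
  TSClause (var p)    F = ⊤
  TSClause (¬' χ)     F = (¬' χ) ∈F F ⟺ ¬ (χ ∈F F)
  TSClause (χ₁ ∧' χ₂) F = (χ₁ ∧' χ₂) ∈F F ⟺ (χ₁ ∈F F × χ₂ ∈F F)
  TSClause (□ χ)      F = BoxClause X χ F
  TSClause (K χ)      F = K χ ∈F F → χ ∈F F

  IsTableauSet : FSet → Set
  IsTableauSet F = (i : Fin n) → TSClause (lookupL (sf φ) i) F

  -- X-tableau-cloud w.r.t. φ (a finite set of subsets of sf(φ), given as a list)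
  IsCloud : List FSet → Set
  IsCloud 𝓕 =
      All IsTableauSet 𝓕
    × (∀ {F G} → F ∈ 𝓕 → G ∈ 𝓕 → ∀ χ → K χ ∈F F ⟺ K χ ∈F G)
    × (∀ χ → K χ ∈ sf φ → (∀ {F} → F ∈ 𝓕 → χ ∈F F) → ∀ {F} → F ∈ 𝓕 → K χ ∈F F)

  Cloud : Set
  Cloud = Σ (List FSet) IsCloud

  elems : Cloud → List FSet
  elems (𝓕 , _) = 𝓕

  infix 4 _≈C_
  _≈C_ : Cloud → Cloud → Set
  𝓕 ≈C 𝓖 = ∀ F → F ∈ elems 𝓕 ⟺ F ∈ elems 𝓖

  Pre : Logic → FSet → FSet → Set
  Pre K4×S5 F G = (∀ χ → □ χ ∈F F → □ χ ∈F G) × (∀ ψ → □ ψ ∈F F → ψ ∈F G)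
  Pre S4×S5 F G = (∀ χ → □ χ ∈F F → □ χ ∈F G)
  Pre SSL   F G = (∀ χ → □ χ ∈F F → □ χ ∈F G) × (∀ p → var p ∈F F ⟺ var p ∈F G)

  infix 4 _≼_
  _≼_ : FSet → FSet → Set
  F ≼ G = Pre X F G

  Forth : Logic → Cloud → Cloud → Set
  Forth K4×S5 𝓕 𝓖 = ∀ F → F ∈ elems 𝓕 → Σ FSet λ G → G ∈ elems 𝓖 × F ≼ G
  Forth S4×S5 𝓕 𝓖 = ∀ F → F ∈ elems 𝓕 → Σ FSet λ G → G ∈ elems 𝓖 × F ≼ G
  Forth SSL   𝓕 𝓖 = ⊤

  infix 4 _≤C_
  _≤C_ : Cloud → Cloud → Set
  𝓕 ≤C 𝓖 = (∀ G → G ∈ elems 𝓖 → Σ FSet λ F → F ∈ elems 𝓕 × F ≼ G) × Forth X 𝓕 𝓖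

  Witness : Cloud → FSet → Fm → Set
  Witness 𝓖 F χ = Σ FSet λ G → G ∈ elems 𝓖 × F ≼ G × ¬ (χ ∈F G)

  PairwiseDifferent : ∀ {m} → Vec Cloud (suc m) → Set
  PairwiseDifferent s = ∀ i j → ¬ (i ≡ j) → ¬ (lookup s i ≈C lookup s j)

  IsChain : ∀ {m} → Vec Cloud (suc m) → Set
  IsChain {m} s = (i : Fin m) → lookup s (inject₁ i) ≤C lookup s (Data.Fin.suc i)

  -- The algorithm is a terminating recursion
  -- (each new cloud differs from all earlier ones and there are only finitely
  -- many clouds), so its "yes"-set is exactly this inductively defined predicate.
  data AlgYes : ∀ {m} → Vec Cloud (suc m) → Set where
    algYes : ∀ {m} {s : Vec Cloud (suc m)} →
      (∀ F → F ∈ elems (last s) → ∀ χ → □ χ ∈ sf φ → ¬ (□ χ ∈F F) →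
          (Σ (Fin (suc m)) λ i → (last s ≤C lookup s i) × Witness (lookup s i) F χ)
        ⊎ (Σ Cloud λ 𝓖 → (∀ i → ¬ (𝓖 ≈C lookup s i)) × (last s ≤C 𝓖)
                        × Witness 𝓖 F χ × AlgYes (s ∷ʳ 𝓖)))
      → AlgYes s

  -- partial X-tableau for (φ,𝓕₀,…,𝓕ₘ); a set of clouds given as a (finite) list,
  -- membership taken up to equality of clouds as sets
  IsPartialTableau : ∀ {m} → Vec Cloud (suc m) → List Cloud → Set
  IsPartialTableau {m} s 𝔗 =
      (∀ (i : Fin (suc m)) → Any (lookup s i ≈C_) 𝔗)
    × All (λ 𝓕 → (∀ (i : Fin m) → ¬ (𝓕 ≈C lookup s (inject₁ i))) →
                 ∀ F → F ∈ elems 𝓕 → ∀ χ → □ χ ∈ sf φ → ¬ (□ χ ∈F F) →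
                 Any (λ 𝓖 → 𝓕 ≤C 𝓖 × Witness 𝓖 F χ) 𝔗) 𝔗

module Submission where

-- An obligation of a cloud 𝓕 in a set of clouds 𝔗 is a pair (F, □χ) with F ∈ 𝓕 and
-- □χ ∉ F; it is discharged in 𝔗 if some 𝓖 ∈ 𝔗 has 𝓕 ≤ 𝓖 and a G ∈ 𝓖 with F ≼ G, χ ∉ G.
--
-- (⇒) By induction on the successful run.  Every obligation of 𝓕ₘ is discharged either
-- by some 𝓕ᵢ (case (I)) or by a fresh cloud 𝓖 for which the recursive run, by induction,
-- yields a partial tableau 𝔘_𝓖 for (𝓕₀,…,𝓕ₘ,𝓖) (case (II)).  The list 𝓕₀,…,𝓕ₘ followed
-- by all these 𝔘_𝓖 is a partial tableau: a cloud of some 𝔘_𝓖 is either (equal to) 𝓕ₘ,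
-- whose obligations are discharged by construction, or distinct from 𝓕₀,…,𝓕ₘ, in which
-- case 𝔘_𝓖 already discharges its obligations.
--
-- (⇐) By induction on |𝔗| - m.  Obligations of 𝓕ₘ are discharged in 𝔗 by some 𝓖; if 𝓖 is
-- one of the 𝓕ᵢ this is case (I), otherwise 𝔗 is also a partial tableau for the longer
-- sequence (𝓕₀,…,𝓕ₘ,𝓖), which is still pairwise different.  Since a pairwise different
-- sequence embeds injectively into 𝔗 (pigeonhole), the sequence cannot outgrow 𝔗.

open import Defs
open import Data.Nat using (ℕ; zero; suc; _≤_; _+_)
open import Data.Nat.Properties using (≤-trans; ≤-reflexive; +-identityʳ; +-suc; n≤1+n; 1+n≰n; m≤n+m)
open import Data.Fin using (Fin; zero; suc; inject₁; fromℕ)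
import Data.Fin.Properties as FinP
import Data.Fin.Subset.Properties as SubP
import Data.Bool as Bool
open import Data.Vec using (Vec; []; _∷_; lookup; last; _∷ʳ_)
import Data.Vec.Properties as VecP
open import Data.List using (List; []; _∷_; _++_; length; tabulate)
import Data.List as List
open import Data.List.Membership.Propositional using (_∈_; find; lose)
open import Data.List.Membership.Propositional.Properties using (∈-tabulate⁺; ∈-tabulate⁻)
import Data.List.Membership.DecPropositional as DecMembership
open import Data.List.Relation.Unary.Any as Any using (Any; here; there)
open import Data.List.Relation.Unary.Any.Properties using (lookup-index)
open import Data.List.Relation.Unary.All as All using (All; [])
import Data.List.Relation.Unary.All.Properties as AllP
open import Data.List.Relation.Binary.Subset.Propositional using (_⊆_)
open import Data.List.Relation.Binary.Subset.Propositional.Properties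
  using (xs⊆xs++ys; xs⊆ys++xs; ++⁺ʳ; Any-resp-⊆)
open import Data.Product using (Σ; _×_; _,_; proj₁; proj₂)
open import Data.Sum using (_⊎_; inj₁; inj₂)
open import Data.Empty using (⊥-elim)
open import Relation.Nullary using (¬_; Dec; yes; no)
open import Relation.Nullary.Decidable using (_×-dec_)
open import Relation.Binary.PropositionalEquality using (_≡_; refl; sym; cong; subst)

module _ {A B : Set} (P : A → List B → Set) (S : List B → Set)
         (P-mono : ∀ {x ys zs} → ys ⊆ zs → P x ys → P x zs)
         (S-[] : S []) (S-++ : ∀ {ys zs} → S ys → S zs → S (ys ++ zs)) where

  gather : (xs : List A) → (∀ {x} → x ∈ xs → Σ (List B) λ ys → S ys × P x ys) →
           Σ (List B) λ ys → S ys × (∀ {x} → x ∈ xs → P x ys)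
  gather [] choose = [] , S-[] , λ ()
  gather (x ∷ xs) choose with choose (here refl) | gather xs (λ x∈ → choose (there x∈))
  ... | ys , Sys , Pys | zs , Szs , Pzs = ys ++ zs , S-++ Sys Szs , serves
    where
    serves : ∀ {y} → y ∈ x ∷ xs → P y (ys ++ zs)
    serves (here refl) = P-mono (xs⊆xs++ys ys zs) Pys
    serves (there y∈) = P-mono (xs⊆ys++xs zs ys) (Pzs y∈)

data Inject₁OrLast {n : ℕ} : Fin (suc n) → Set where
  inject : (j : Fin n) → Inject₁OrLast (inject₁ j)
  final  : Inject₁OrLast (fromℕ n)

inject₁OrLast : ∀ {n} (i : Fin (suc n)) → Inject₁OrLast i
inject₁OrLast {zero} zero = final
inject₁OrLast {suc n} zero = inject zero
inject₁OrLast {suc n} (suc i) with inject₁OrLast i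
... | inject j = inject (suc j)
... | final = final

module _ {A : Set} where

  lookup-∷ʳ-inject₁ : ∀ {n} (xs : Vec A n) x (i : Fin n) → lookup (xs ∷ʳ x) (inject₁ i) ≡ lookup xs i
  lookup-∷ʳ-inject₁ (y ∷ xs) x zero = refl
  lookup-∷ʳ-inject₁ (y ∷ xs) x (suc i) = lookup-∷ʳ-inject₁ xs x i

  lookup-∷ʳ-fromℕ : ∀ {n} (xs : Vec A n) x → lookup (xs ∷ʳ x) (fromℕ n) ≡ x
  lookup-∷ʳ-fromℕ [] x = refl
  lookup-∷ʳ-fromℕ (y ∷ xs) x = lookup-∷ʳ-fromℕ xs x

  last≡lookup-fromℕ : ∀ {n} (xs : Vec A (suc n)) → last xs ≡ lookup xs (fromℕ n)
  last≡lookup-fromℕ (x ∷ []) = refl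
  last≡lookup-fromℕ (x ∷ y ∷ xs) = last≡lookup-fromℕ (y ∷ xs)

module Tableaux (X : Logic) (φ : Fm) where
  open Tab X φ

  -- equality of clouds as sets is equality of their lists of elements as sets, which
  -- is an equivalence relation (stated on lists, from which Agda can infer arguments)
  _≃_ : List FSet → List FSet → Set
  xs ≃ ys = ∀ F → F ∈ xs ⟺ F ∈ ys

  ≃-refl : ∀ {xs} → xs ≃ xs
  ≃-refl F = (λ F∈ → F∈) , (λ F∈ → F∈)

  ≃-sym : ∀ {xs ys} → xs ≃ ys → ys ≃ xs
  ≃-sym e F = proj₂ (e F) , proj₁ (e F)

  ≃-trans : ∀ {xs ys zs} → xs ≃ ys → ys ≃ zs → xs ≃ zs
  ≃-trans e e′ F = (λ F∈ → proj₁ (e′ F) (proj₁ (e F) F∈)) , (λ F∈ → proj₂ (e F) (proj₂ (e′ F) F∈))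

  ≡⇒≈ : ∀ {𝓕 𝓖} → 𝓕 ≡ 𝓖 → 𝓕 ≈C 𝓖
  ≡⇒≈ refl = ≃-refl

  open DecMembership (VecP.≡-dec {n = n} Bool._≟_) using () renaming (_∈?_ to _∈FSets?_)

  _≈?_ : ∀ 𝓕 𝓖 → Dec (𝓕 ≈C 𝓖)
  𝓕 ≈? 𝓖 with All.all? (_∈FSets? elems 𝓖) (elems 𝓕) | All.all? (_∈FSets? elems 𝓕) (elems 𝓖)
  ... | yes 𝓕⊆𝓖 | yes 𝓖⊆𝓕 = yes λ F → All.lookup 𝓕⊆𝓖 , All.lookup 𝓖⊆𝓕
  ... | no 𝓕⊈𝓖 | _ = no λ e → 𝓕⊈𝓖 (All.tabulate λ {F} → proj₁ (e F))
  ... | yes _ | no 𝓖⊈𝓕 = no λ e → 𝓖⊈𝓕 (All.tabulate λ {F} → proj₂ (e F))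

  _∈F?_ : ∀ ψ F → Dec (ψ ∈F F)
  ψ ∈F? F = FinP.any? λ i → (List.lookup (sf φ) i ≟F ψ) ×-dec (i SubP.∈? F)

  Forth-resp : ∀ L {𝓕 𝓕′ 𝓖 𝓖′} → 𝓕 ≈C 𝓕′ → 𝓖 ≈C 𝓖′ → Forth L 𝓕 𝓖 → Forth L 𝓕′ 𝓖′
  Forth-resp K4×S5 e e′ forth F F∈ with forth F (proj₂ (e F) F∈)
  ... | G , G∈ , F≼G = G , proj₁ (e′ G) G∈ , F≼G
  Forth-resp S4×S5 e e′ forth F F∈ with forth F (proj₂ (e F) F∈)
  ... | G , G∈ , F≼G = G , proj₁ (e′ G) G∈ , F≼G
  Forth-resp SSL e e′ forth = forth

  ≤C-resp : ∀ {𝓕 𝓕′ 𝓖 𝓖′} → 𝓕 ≈C 𝓕′ → 𝓖 ≈C 𝓖′ → 𝓕 ≤C 𝓖 → 𝓕′ ≤C 𝓖′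
  ≤C-resp {𝓕} {𝓕′} {𝓖} {𝓖′} e e′ (back , forth) = back′ , Forth-resp X {𝓕} {𝓕′} {𝓖} {𝓖′} e e′ forth
    where
    back′ : ∀ G → G ∈ elems 𝓖′ → Σ FSet λ F → F ∈ elems 𝓕′ × F ≼ G
    back′ G G∈ with back G (proj₂ (e′ G) G∈)
    ... | F , F∈ , F≼G = F , proj₁ (e F) F∈ , F≼G

  Witness-resp : ∀ {𝓖 𝓖′ F χ} → 𝓖 ≈C 𝓖′ → Witness 𝓖 F χ → Witness 𝓖′ F χ
  Witness-resp e (G , G∈ , F≼G , χ∉G) = G , proj₁ (e G) G∈ , F≼G , χ∉G

  Discharged : Cloud → List Cloud → FSet → Fm → Set
  Discharged 𝓕 𝔗 F χ = Any (λ 𝓖 → 𝓕 ≤C 𝓖 × Witness 𝓖 F χ) 𝔗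

  Settled : Cloud → List Cloud → Set
  Settled 𝓕 𝔗 = ∀ F → F ∈ elems 𝓕 → ∀ χ → □ χ ∈ sf φ → ¬ (□ χ ∈F F) → Discharged 𝓕 𝔗 F χ

  Settled-resp : ∀ {𝓕 𝓕′ 𝔗} → 𝓕 ≈C 𝓕′ → Settled 𝓕 𝔗 → Settled 𝓕′ 𝔗
  Settled-resp {𝓕} {𝓕′} e settled F F∈ χ r χ∉ =
    Any.map (λ {𝓖} (le , w) → ≤C-resp {𝓕} {𝓕′} {𝓖} {𝓖} e ≃-refl le , w) (settled F (proj₂ (e F) F∈) χ r χ∉)

  Settled-mono : ∀ {𝓕 𝔗 𝔗′} → 𝔗 ⊆ 𝔗′ → Settled 𝓕 𝔗 → Settled 𝓕 𝔗′
  Settled-mono sub settled F F∈ χ r χ∉ = Any-resp-⊆ sub (settled F F∈ χ r χ∉)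

  Closed : ∀ {m} → Vec Cloud (suc m) → List Cloud → Cloud → Set
  Closed {m} s 𝔗 𝓕 = (∀ (j : Fin m) → ¬ (𝓕 ≈C lookup s (inject₁ j))) → Settled 𝓕 𝔗

  Fresh : ∀ {m} → Vec Cloud (suc m) → Cloud → Set
  Fresh s 𝓖 = ∀ i → ¬ (𝓖 ≈C lookup s i)

  close : ∀ {m} (s : Vec Cloud (suc m)) {𝔗} 𝓕 → Settled (last s) 𝔗 →
          (Fresh s 𝓕 → Settled 𝓕 𝔗) → Closed s 𝔗 𝓕
  close s 𝓕 settled settleFresh notEarly with 𝓕 ≈? last s
  ... | yes 𝓕≈last = Settled-resp (≃-sym 𝓕≈last) settled
  ... | no 𝓕≉last = settleFresh λ i → differs (inject₁OrLast i)
    where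
    differs : ∀ {i} → Inject₁OrLast i → ¬ (𝓕 ≈C lookup s i)
    differs (inject j) = notEarly j
    differs final e = 𝓕≉last (≃-trans e (≡⇒≈ (sym (last≡lookup-fromℕ s))))

  Reused : ∀ {m} → Vec Cloud (suc m) → FSet → Fm → Set
  Reused {m} s F χ = Σ (Fin (suc m)) λ i → (last s ≤C lookup s i) × Witness (lookup s i) F χ

  Extended : ∀ {m} → Vec Cloud (suc m) → FSet → Fm → (Vec Cloud (suc (suc m)) → Set) → Set
  Extended s F χ Continues =
    Σ Cloud λ 𝓖 → Fresh s 𝓖 × (last s ≤C 𝓖) × Witness 𝓖 F χ × Continues (s ∷ʳ 𝓖)

  Outcome : ∀ {m} → Vec Cloud (suc m) → FSet → Fm → (Vec Cloud (suc (suc m)) → Set) → Set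
  Outcome s F χ Continues = Reused s F χ ⊎ Extended s F χ Continues

  HasTableau : ∀ {m} → Vec Cloud (suc m) → Set
  HasTableau s = Σ (List Cloud) (IsPartialTableau s)

  prefix : ∀ {m} → Vec Cloud (suc m) → List Cloud
  prefix s = tabulate (lookup s)

  prefix-contains : ∀ {m} (s : Vec Cloud (suc m)) i → Any (lookup s i ≈C_) (prefix s)
  prefix-contains s i = Any.map ≡⇒≈ (∈-tabulate⁺ {f = lookup s} i)

  -- a list of clouds that may be added to a tableau for s: once the last cloud of s is
  -- settled in the whole tableau 𝔗, all clouds of the list are closed in 𝔗
  Sound : ∀ {m} → Vec Cloud (suc m) → List Cloud → Set
  Sound s 𝔘 = ∀ {𝔗} → 𝔘 ⊆ 𝔗 → Settled (last s) 𝔗 → All (Closed s 𝔗) 𝔘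

  sound-[] : ∀ {m} {s : Vec Cloud (suc m)} → Sound s []
  sound-[] _ _ = []

  sound-++ : ∀ {m} {s : Vec Cloud (suc m)} {𝔘 𝔙} → Sound s 𝔘 → Sound s 𝔙 → Sound s (𝔘 ++ 𝔙)
  sound-++ {𝔘 = 𝔘} {𝔙} sound𝔘 sound𝔙 sub settled =
    AllP.++⁺ (sound𝔘 (λ x∈ → sub (xs⊆xs++ys 𝔘 𝔙 x∈)) settled)
             (sound𝔙 (λ x∈ → sub (xs⊆ys++xs 𝔙 𝔘 x∈)) settled)

  -- no cloud of s is fresh, so the clouds of s are closed once the last one is settled
  prefix-sound : ∀ {m} (s : Vec Cloud (suc m)) → Sound s (prefix s)
  prefix-sound s _ settled = All.tabulate λ {𝓕} 𝓕∈ → close s 𝓕 settled λ fresh →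
    let i , 𝓕≡ = ∈-tabulate⁻ {f = lookup s} 𝓕∈ in ⊥-elim (fresh i (≡⇒≈ 𝓕≡))

  -- a partial tableau for s extended by 𝓖 may be added to a tableau for s: its fresh
  -- clouds are already closed with respect to the extended sequence
  tableau-sound : ∀ {m} (s : Vec Cloud (suc m)) 𝓖 {𝔘} → IsPartialTableau (s ∷ʳ 𝓖) 𝔘 → Sound s 𝔘
  tableau-sound s 𝓖 (_ , closed) sub settled = All.tabulate λ {𝓕} 𝓕∈ → close s 𝓕 settled λ fresh →
    Settled-mono sub (All.lookup closed 𝓕∈ λ i e → fresh i (≃-trans e (≡⇒≈ (lookup-∷ʳ-inject₁ s 𝓖 i))))

  discharge : ∀ {m} (s : Vec Cloud (suc m)) {F χ} → Outcome s F χ HasTableau →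
              Σ (List Cloud) λ 𝔘 → Sound s 𝔘 × Discharged (last s) (prefix s ++ 𝔘) F χ
  discharge s (inj₁ (i , le , w)) =
    [] , sound-[] , Any-resp-⊆ (xs⊆xs++ys (prefix s) []) (lose (∈-tabulate⁺ {f = lookup s} i) (le , w))
  discharge {m} s {F} {χ} (inj₂ (𝓖 , _ , le , w , 𝔘 , tableau)) =
    𝔘 , tableau-sound s 𝓖 tableau , Any-resp-⊆ (xs⊆ys++xs 𝔘 (prefix s)) (Any.map transport 𝓖∈𝔘)
    where
    𝓖∈𝔘 : Any (lookup (s ∷ʳ 𝓖) (fromℕ (suc m)) ≈C_) 𝔘
    𝓖∈𝔘 = proj₁ tableau (fromℕ (suc m))
    transport : ∀ {𝓗} → lookup (s ∷ʳ 𝓖) (fromℕ (suc m)) ≈C 𝓗 → last s ≤C 𝓗 × Witness 𝓗 F χ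
    transport {𝓗} e = ≤C-resp {last s} {last s} {𝓖} {𝓗} ≃-refl 𝓖≈ le , Witness-resp {𝓖} {𝓗} 𝓖≈ w
      where 𝓖≈ = ≃-trans (≡⇒≈ (sym (lookup-∷ʳ-fromℕ s 𝓖))) e

  -- if every obligation of the last cloud of s has an outcome, then s has a partial tableau:
  -- the clouds of s followed by the sound lists of all outcomes
  extend : ∀ {m} (s : Vec Cloud (suc m)) →
           (∀ F → F ∈ elems (last s) → ∀ χ → □ χ ∈ sf φ → ¬ (□ χ ∈F F) → Outcome s F χ HasTableau) →
           HasTableau s
  extend s outcome = prefix s ++ 𝔘 , contains , AllP.++⁺ (prefix-sound s inPrefix settled) (sound𝔘 in𝔘 settled)
    where
    Discharges : FSet → Fm → List Cloud → Set
    Discharges F χ 𝔙 = Discharged (last s) (prefix s ++ 𝔙) F χ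

    Discharges-mono : ∀ {F χ 𝔙 𝔙′} → 𝔙 ⊆ 𝔙′ → Discharges F χ 𝔙 → Discharges F χ 𝔙′
    Discharges-mono sub = Any-resp-⊆ (++⁺ʳ (prefix s) sub)

    AtSubformula : FSet → Fm → List Cloud → Set
    AtSubformula F ψ 𝔙 = ∀ χ → ψ ≡ □ χ → ¬ (□ χ ∈F F) → Discharges F χ 𝔙

    AtSet : FSet → List Cloud → Set
    AtSet F 𝔙 = ∀ χ → □ χ ∈ sf φ → ¬ (□ χ ∈F F) → Discharges F χ 𝔙

    atSubformula : ∀ {F} → F ∈ elems (last s) → ∀ {ψ} → ψ ∈ sf φ →
                   Σ (List Cloud) λ 𝔙 → Sound s 𝔙 × AtSubformula F ψ 𝔙
    atSubformula {F} F∈ {□ χ} r with (□ χ) ∈F? F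
    ... | yes □χ∈F = [] , sound-[] , λ { _ refl □χ∉F → ⊥-elim (□χ∉F □χ∈F) }
    ... | no □χ∉F with discharge s (outcome F F∈ χ r □χ∉F)
    ...   | 𝔙 , sound𝔙 , discharged = 𝔙 , sound𝔙 , λ { _ refl _ → discharged }
    atSubformula F∈ {var _} r = [] , sound-[] , λ _ ()
    atSubformula F∈ {¬' _} r = [] , sound-[] , λ _ ()
    atSubformula F∈ {_ ∧' _} r = [] , sound-[] , λ _ ()
    atSubformula F∈ {K _} r = [] , sound-[] , λ _ ()

    atSet : ∀ {F} → F ∈ elems (last s) → Σ (List Cloud) λ 𝔙 → Sound s 𝔙 × AtSet F 𝔙
    atSet {F} F∈ with gather (AtSubformula F) (Sound s) (λ sub d χ eq χ∉ → Discharges-mono sub (d χ eq χ∉))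
                             sound-[] sound-++ (sf φ) (atSubformula F∈)
    ... | 𝔙 , sound𝔙 , atAll = 𝔙 , sound𝔙 , λ χ r → atAll r χ refl

    collected : Σ (List Cloud) λ 𝔘 → Sound s 𝔘 × (∀ {F} → F ∈ elems (last s) → AtSet F 𝔘)
    collected = gather AtSet (Sound s) (λ sub d χ r χ∉ → Discharges-mono sub (d χ r χ∉))
                       sound-[] sound-++ (elems (last s)) atSet

    𝔘 : List Cloud
    𝔘 = proj₁ collected

    sound𝔘 : Sound s 𝔘
    sound𝔘 = proj₁ (proj₂ collected)

    settled : Settled (last s) (prefix s ++ 𝔘)
    settled F F∈ = proj₂ (proj₂ collected) F∈

    inPrefix : prefix s ⊆ prefix s ++ 𝔘
    inPrefix = xs⊆xs++ys (prefix s) 𝔘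

    in𝔘 : 𝔘 ⊆ prefix s ++ 𝔘
    in𝔘 = xs⊆ys++xs 𝔘 (prefix s)

    contains : ∀ i → Any (lookup s i ≈C_) (prefix s ++ 𝔘)
    contains i = Any-resp-⊆ inPrefix (prefix-contains s i)

  mutual
    algYes⇒tableau : ∀ {m} {s : Vec Cloud (suc m)} → AlgYes s → HasTableau s
    algYes⇒tableau {s = s} (algYes run) = extend s λ F F∈ χ r χ∉ → recurse (run F F∈ χ r χ∉)

    recurse : ∀ {m} {s : Vec Cloud (suc m)} {F χ} → Outcome s F χ AlgYes → Outcome s F χ HasTableau
    recurse (inj₁ reused) = inj₁ reused
    recurse (inj₂ (𝓖 , fresh , le , w , run)) = inj₂ (𝓖 , fresh , le , w , algYes⇒tableau run)

  tableau-size : ∀ {m} (s : Vec Cloud (suc m)) {𝔗} → PairwiseDifferent s →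
                 (∀ i → Any (lookup s i ≈C_) 𝔗) → suc m ≤ length 𝔗
  tableau-size s {𝔗} different contains = FinP.injective⇒≤ position-injective
    where
    position : ∀ i → Fin (length 𝔗)
    position i = Any.index (contains i)

    position-injective : ∀ {i j} → position i ≡ position j → i ≡ j
    position-injective {i} {j} same with i FinP.≟ j
    ... | yes i≡j = i≡j
    ... | no i≢j = ⊥-elim (different i j i≢j (≃-trans (lookup-index (contains i)) (≃-sym at-j)))
      where
      at-j : lookup s j ≈C List.lookup 𝔗 (position i)
      at-j = subst (λ k → lookup s j ≈C List.lookup 𝔗 k) (sym same) (lookup-index (contains j))

  last-settled : ∀ {m} (s : Vec Cloud (suc m)) {𝔗} → PairwiseDifferent s → IsPartialTableau s 𝔗 →
                 Settled (last s) 𝔗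
  last-settled {m} s {𝔗} different (contains , closed) with find (contains (fromℕ m))
  ... | 𝓣 , 𝓣∈ , last≈𝓣 = Settled-resp (≃-sym (≃-trans (≡⇒≈ (last≡lookup-fromℕ s)) last≈𝓣)) settled𝓣
    where
    settled𝓣 : Settled 𝓣 𝔗
    settled𝓣 = All.lookup closed 𝓣∈ λ j e →
      different (fromℕ m) (inject₁ j) FinP.fromℕ≢inject₁ (≃-trans last≈𝓣 e)

  ∷ʳ-pairwiseDifferent : ∀ {m} (s : Vec Cloud (suc m)) {𝓖} → PairwiseDifferent s → Fresh s 𝓖 →
                         PairwiseDifferent (s ∷ʳ 𝓖)
  ∷ʳ-pairwiseDifferent {m} s {𝓖} different fresh i j i≢j = go (inject₁OrLast i) (inject₁OrLast j) i≢j
    where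
    old : ∀ k → lookup (s ∷ʳ 𝓖) (inject₁ k) ≈C lookup s k
    old k = ≡⇒≈ (lookup-∷ʳ-inject₁ s 𝓖 k)

    new : lookup (s ∷ʳ 𝓖) (fromℕ (suc m)) ≈C 𝓖
    new = ≡⇒≈ (lookup-∷ʳ-fromℕ s 𝓖)

    go : ∀ {i j} → Inject₁OrLast i → Inject₁OrLast j → ¬ (i ≡ j) →
         ¬ (lookup (s ∷ʳ 𝓖) i ≈C lookup (s ∷ʳ 𝓖) j)
    go (inject a) (inject b) a≢b e =
      different a b (λ a≡b → a≢b (cong inject₁ a≡b)) (≃-trans (≃-sym (old a)) (≃-trans e (old b)))
    go (inject a) final _ e = fresh a (≃-trans (≃-sym new) (≃-trans (≃-sym e) (old a)))
    go final (inject b) _ e = fresh b (≃-trans (≃-sym new) (≃-trans e (old b)))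
    go final final last≢last _ = last≢last refl

  ∷ʳ-partialTableau : ∀ {m} (s : Vec Cloud (suc m)) {𝓖 𝔗} → 𝓖 ∈ 𝔗 →
                      IsPartialTableau s 𝔗 → IsPartialTableau (s ∷ʳ 𝓖) 𝔗
  ∷ʳ-partialTableau s {𝓖} {𝔗} 𝓖∈ (contains , closed) =
    (λ i → contains′ (inject₁OrLast i)) ,
    All.map (λ close𝓕 notEarly → close𝓕 λ j e →
               notEarly (inject₁ j) (≃-trans e (≡⇒≈ (sym (lookup-∷ʳ-inject₁ s 𝓖 (inject₁ j))))))
            closed
    where
    contains′ : ∀ {i} → Inject₁OrLast i → Any (lookup (s ∷ʳ 𝓖) i ≈C_) 𝔗
    contains′ (inject j) = Any.map (≃-trans (≡⇒≈ (lookup-∷ʳ-inject₁ s 𝓖 j))) (contains j)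
    contains′ final = lose 𝓖∈ (≡⇒≈ (lookup-∷ʳ-fromℕ s 𝓖))

  -- the run succeeds on every pairwise different s with a partial tableau 𝔗, by
  -- induction on the number of clouds of 𝔗 that are not yet in s
  tableau⇒algYes : ∀ fuel {m} (s : Vec Cloud (suc m)) {𝔗} → length 𝔗 ≤ m + fuel →
                   PairwiseDifferent s → IsPartialTableau s 𝔗 → AlgYes s
  tableau⇒algYes fuel {m} s {𝔗} bound different tableau =
    algYes λ F F∈ χ r χ∉ → outcome (last-settled s different tableau F F∈ χ r χ∉)
    where
    grow : ∀ fuel → length 𝔗 ≤ m + fuel → ∀ {𝓖} → 𝓖 ∈ 𝔗 → Fresh s 𝓖 → AlgYes (s ∷ʳ 𝓖)
    grow zero bound {𝓖} 𝓖∈ fresh = ⊥-elim (1+n≰n (≤-trans (n≤1+n (suc m)) (≤-trans size bound′)))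
      where
      size : suc (suc m) ≤ length 𝔗
      size = tableau-size (s ∷ʳ 𝓖) (∷ʳ-pairwiseDifferent s different fresh)
                          (proj₁ (∷ʳ-partialTableau s 𝓖∈ tableau))
      bound′ : length 𝔗 ≤ m
      bound′ = ≤-trans bound (≤-reflexive (+-identityʳ m))
    grow (suc fuel) bound {𝓖} 𝓖∈ fresh =
      tableau⇒algYes fuel (s ∷ʳ 𝓖) (≤-trans bound (≤-reflexive (+-suc m fuel)))
                     (∷ʳ-pairwiseDifferent s different fresh) (∷ʳ-partialTableau s 𝓖∈ tableau)

    outcome : ∀ {F χ} → Discharged (last s) 𝔗 F χ → Outcome s F χ AlgYes
    outcome discharged with find discharged
    ... | 𝓖 , 𝓖∈ , le , w with FinP.any? (λ i → 𝓖 ≈? lookup s i)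
    ...   | yes (i , 𝓖≈) =
      inj₁ (i , ≤C-resp {last s} {last s} {𝓖} {lookup s i} ≃-refl 𝓖≈ le , Witness-resp {𝓖} {lookup s i} 𝓖≈ w)
    ...   | no notOld = inj₂ (𝓖 , fresh , le , w , grow fuel bound 𝓖∈ fresh)
      where
      fresh : Fresh s 𝓖
      fresh i 𝓖≈ = notOld (i , 𝓖≈)

proposition7p2 : (X : Logic) (φ : Fm) (m : ℕ) (s : Vec (Tab.Cloud X φ) (suc m)) →
    Tab.PairwiseDifferent X φ s → Tab.IsChain X φ s →
    Tab.AlgYes X φ s ⟺ Σ (List (Tab.Cloud X φ)) (Tab.IsPartialTableau X φ s)
proposition7p2 X φ m s different _ = algYes⇒tableau , fromTableau
  where
  open Tableaux X φ

  fromTableau : HasTableau s → Tab.AlgYes X φ s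
  fromTableau (𝔗 , tableau) = tableau⇒algYes (length 𝔗) s (m≤n+m (length 𝔗) m) different tableau
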